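{- Let $R$ be a $K$-node pattern and $G$ a $d$-degenerate graph with a vertex partition $(V_u)_{u\in V(R)}$. Suppose that the procedure described below is applied to $H=G^R$, $d$ and $K$ (with arbitrary choices where choices are made), and it outputs a graph $F$. Then there exists a set $U$ of at most $4000dK^6$ vertices of $H$ such that the graphs $F\setminus U$ and $E^R\setminus U$ are the same, where $E$ is the edgeless graph with vertex set $V(H)$ (and $E^R$ is formed with respect to the same partition $(V_u)_{u\in V(R)}$).
   Context: Graphs are finite and simple; a graph is $d$-degenerate if its vertices can be ordered so that each vertex has at most $d$ neighbors preceding it. A pattern is a finite graph $R$ possibly with loops (vertices called nodes) containing neither two adjacent twins both having loops nor two non-adjacent twins neither having a loop (nodes $u,u'$ are twins if every other node is adjacent to both or neither). For a partition $(V_u)_{u\in V(R)}$ of $V(G)$, the graph $G^R$ on $V(G)$ is obtained from $G$ by complementing adjacency between all pairs of distinct vertices inside $V_u$ for each node $u$ with a loop and between $V_u$ and $V_{u'}$ for each edge $uu'$ of $R$ with $u\ne u'$. Two sets $X,Y$ are $k$-similar if $|X\triangle Y|\le k$; the $k$-similarity graph of a graph $H$ has vertex set $V(H)$, two vertices adjacent iff their neighborhoods in $H$ are $k$-similar. The procedure: input a graph $H$ and integers $d,K$. Set $W:=V(H)$, let $F$ be the edgeless graph on $V(H)$, $k:=0$, and $\mathcal{S}:=\emptyset$. While $|W|\ge 1100dK^5$: if there exist $v\in W$ and $S_i\in\mathcal{S}$ such that the neighborhood $N_{H[W]}(v)$ is $(1140dK^4)$-similar to $S_i\cap W$, then set $W:=W\setminus\{v\}$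 and join $v$ in $F$ to all vertices of $S_i\cap W$ (with the updated $W$); otherwise, let $v$ be a vertex of maximum degree in the $(160dK^3)$-similarity graph of $H[W]$, set $k:=k+1$, let $S_k$ be the set of neighbors of $v$ in $H[W]$, and add $S_k$ to $\mathcal{S}$. When the loop ends, output $F$. -}

module Defs where

open import Data.Nat using (ℕ; zero; suc; _+_; _*_; _^_; _≤_; _<_)
open import Data.Bool using (Bool; true; false; _∧_; _∨_; _xor_; not; if_then_else_)
open import Data.Fin using (Fin; _≟_)
import Data.Fin
import Data.Nat
import Data.List
open import Data.List using (List; []; _∷_; length; filter; lookup)
open import Data.List.Membership.Propositional using (_∈_)
open import Data.Vec.Functional using (Vector)
open import Data.Product using (Σ; _×_; _,_; ∃)
open import Relation.Nullary using (¬_; does)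
open import Relation.Binary.PropositionalEquality using (_≡_; _≢_)
open import Function.Definitions using (Injective)

VSet : ℕ → Set
VSet n = Fin n → Bool

Adj : ℕ → Set
Adj n = Fin n → Fin n → Bool

count : ∀ {n} → VSet n → ℕ
count {zero}  P = 0
count {suc n} P = (if P Data.Fin.zero then 1 else 0) + count (λ i → P (Data.Fin.suc i))

eqb : ∀ {n} → Fin n → Fin n → Bool
eqb x y = does (x ≟ y)

symDiffSize : ∀ {n} → VSet n → VSet n → ℕ
symDiffSize A B = count (λ x → A x xor B x)

record IsSimpleGraph {n : ℕ} (G : Adj n) : Set where
  field
    symmetric   : ∀ x y → G x y ≡ G y x
    irreflexive : ∀ x → G x x ≡ false

-- d-degenerate: an ordering (an injective position map σ into Fin n,
-- i.e. a permutation) such that each vertex has at most d neighbours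
-- preceding it.
Degenerate : ∀ {n} → ℕ → Adj n → Set
Degenerate {n} d G =
  Σ (Fin n → Fin n) λ σ → Injective _≡_ _≡_ σ ×
    (∀ v → count (λ w → G v w ∧ does (Data.Fin._<?_ (σ w) (σ v))) ≤ d)

-- Patterns on K nodes: a symmetric relation on Fin K; R u u = loop at u.

Twins : ∀ {K} → Adj K → Fin K → Fin K → Set
Twins R u u' = ∀ w → w ≢ u → w ≢ u' → R w u ≡ R w u'

record IsPattern {K : ℕ} (R : Adj K) : Set where
  field
    symmetric : ∀ u v → R u v ≡ R v u
    noAdjLoopedTwins :
      ∀ u u' → u ≢ u' → Twins R u u' →
      ¬ (R u u' ≡ true × R u u ≡ true × R u' u' ≡ true)
    noNonadjLooplessTwins :
      ∀ u u' → u ≢ u' → Twins R u u' →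
      ¬ (R u u' ≡ false × R u u ≡ false × R u' u' ≡ false)

-- G^R for the partition given by part : Fin n → Fin K (V_u = part⁻¹(u)).
-- For distinct x,y: adjacency is flipped iff R (part x) (part y), which is
-- the loop at u when both lie in V_u, and the edge uu' otherwise.
flipR : ∀ {n K} → Adj K → (Fin n → Fin K) → Adj n → Adj n
flipR R part G x y =
  if eqb x y then false else (G x y xor R (part x) (part y))

edgeless : ∀ {n} → Adj n
edgeless x y = false

-- The procedure, as a nondeterministic transition system.

record State (n : ℕ) : Set where
  constructor st
  field
    W  : VSet n
    F  : Adj n
    𝒮  : List (VSet n)

nbhdIn : ∀ {n} → Adj n → VSet n → Fin n → VSet n
nbhdIn H W v x = W x ∧ H v x

_∩_ : ∀ {n} → VSet n → VSet n → VSet n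
(A ∩ B) x = A x ∧ B x

remove : ∀ {n} → VSet n → Fin n → VSet n
remove W v x = W x ∧ not (eqb x v)

joinTo : ∀ {n} → Adj n → Fin n → VSet n → Adj n
joinTo F v S x y = F x y ∨ (eqb x v ∧ S y) ∨ (eqb y v ∧ S x)

simDegree : ∀ {n} → ℕ → Adj n → VSet n → Fin n → ℕ
simDegree c H W v =
  count (λ w → W w ∧ not (eqb w v) ∧
    does (Data.Nat._≤?_ (symDiffSize (nbhdIn H W v) (nbhdIn H W w)) c))

module Procedure {n : ℕ} (H : Adj n) (d K : ℕ) where

  threshold : ℕ
  threshold = 1100 * d * K ^ 5

  Match : VSet n → List (VSet n) → Fin n → VSet n → Set
  Match W 𝒮 v S = W v ≡ true × S ∈ 𝒮 ×
    symDiffSize (nbhdIn H W v) (S ∩ W) ≤ 1140 * d * K ^ 4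

  data Step : State n → State n → Set where
    remove-step : ∀ {W F 𝒮} v S → threshold ≤ count W → Match W 𝒮 v S →
      Step (st W F 𝒮) (st (remove W v) (joinTo F v (S ∩ remove W v)) 𝒮)
    new-step : ∀ {W F 𝒮} v → threshold ≤ count W →
      (¬ ∃ λ u → ∃ λ S → Match W 𝒮 u S) →
      W v ≡ true →
      (∀ w → W w ≡ true →
        simDegree (160 * d * K ^ 3) H W w ≤ simDegree (160 * d * K ^ 3) H W v) →
      Step (st W F 𝒮) (st W F (𝒮 Data.List.++ (nbhdIn H W v ∷ [])))

  data Outputs : State n → Adj n → Set where
    halt : ∀ {W F 𝒮} → count W < threshold → Outputs (st W F 𝒮) F
    next : ∀ {s s' F} → Step s s' → Outputs s' F → Outputs s F

  initial : State n
  initial = st (λ _ → true) edgeless []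

module Submission where

-- The proof is an invariant argument along the run of the procedure.
--  * Counting: sizes of vertex sets (Boolean predicates on Fin n) are sums
--    of indicators, which gives union bounds, splitting and partition sums.
--  * Degenerate graphs: G[A] has at most d|A| edges, so half of A has degree
--    at most 4d in G[A], and few vertices are adjacent to almost all of a
--    large set.
--  * The constants c₀, c₁, α, γ, β, μ and the inequalities between them.
--  * Key lemma (close-row): low-degree vertices of a common part are similar
--    in H[W], so a maximiser v of the similarity degree has large degree,
--    which forces N_{H[W]}(v) to agree with some row of R up to α vertices.
--  * The invariant: each member of 𝒮 is a row of R up to α recorded
--    exceptional vertices, and F agrees with E on all pairs not inside W,
--    except at exceptional vertices, vertices of parts that have become small,
--    and "bad" removed vertices adjacent to almost all of a large part. Both
--    kinds of step preserve it, and when the procedure stops, U is the set of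
--    these vertices together with the final W.

open import Defs
open import Data.Nat using (ℕ; zero; suc; _+_; _*_; _^_; _≤_; _<_; z≤n; s≤s; _≤?_; NonZero; >-nonZero; >-nonZero⁻¹)
open import Data.Nat.Properties hiding (_≟_; _<?_)
open import Data.Nat.Solver using (module +-*-Solver)
open import Data.Bool using (Bool; true; false; _∧_; _∨_; _xor_; not; if_then_else_)
import Data.Bool.Properties as 𝔹
open import Data.Fin using (Fin; _≟_; _<?_) renaming (zero to fzero; suc to fsuc)
import Data.Fin.Properties as FinP
open import Data.Vec.Functional using (foldr)
open import Data.Product using (Σ; ∃; _×_; _,_; proj₁; proj₂)
open import Data.Sum using (_⊎_; inj₁; inj₂)
open import Data.Empty using (⊥-elim)
open import Data.List using (List; []; _∷_; _++_)
open import Data.List.Membership.Propositional using (_∈_)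
open import Data.List.Relation.Unary.Any using (here)
open import Data.List.Membership.Propositional.Properties using (∈-++⁺ˡ; ∈-++⁺ʳ; ∈-++⁻)
open import Relation.Nullary using (¬_; does; yes; no; Dec)
open import Relation.Nullary.Decidable using (dec-true; dec-false)
open import Relation.Binary.PropositionalEquality
open import Function using (_∘_)
open import Algebra.Properties.Semiring.Sum +-*-semiring using (sum; sum-cong-≗; ∑-distrib-+; ∑-comm; *-distribˡ-sum)

true≢false : true ≢ false
true≢false ()

∧-elimˡ : ∀ {a b : Bool} → a ∧ b ≡ true → a ≡ true
∧-elimˡ {true} _ = refl

∧-elimʳ : ∀ {a b : Bool} → a ∧ b ≡ true → b ≡ true
∧-elimʳ {true} h = h

∧-intro : ∀ {a b : Bool} → a ≡ true → b ≡ true → a ∧ b ≡ true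
∧-intro refl refl = refl

∨-introˡ : ∀ {a : Bool} (b : Bool) → a ≡ true → a ∨ b ≡ true
∨-introˡ b refl = refl

∨-introʳ : ∀ (a : Bool) {b : Bool} → b ≡ true → a ∨ b ≡ true
∨-introʳ true  _ = refl
∨-introʳ false h = h

∨-elim : ∀ {a b : Bool} → a ∨ b ≡ true → a ≡ true ⊎ b ≡ true
∨-elim {true}  _ = inj₁ refl
∨-elim {false} h = inj₂ h

∨-false : ∀ {a b : Bool} → a ∨ b ≡ false → a ≡ false × b ≡ false
∨-false {false} {false} _ = refl , refl

not-true : ∀ {a : Bool} → not a ≡ true → a ≡ false
not-true {false} _ = refl

xor-differ : ∀ {a b : Bool} → a ≢ b → (a xor b) ≡ true
xor-differ {false} {false} a≢b = ⊥-elim (a≢b refl)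
xor-differ {false} {true}  _   = refl
xor-differ {true}  {false} _   = refl
xor-differ {true}  {true}  a≢b = ⊥-elim (a≢b refl)

does-sound : ∀ {A : Set} (a? : Dec A) → does a? ≡ true → A
does-sound (yes a) _ = a

does-refute : ∀ {A : Set} (a? : Dec A) → does a? ≡ false → ¬ A
does-refute (no ¬a) _ = ¬a

eqb-refl : ∀ {n} (x : Fin n) → eqb x x ≡ true
eqb-refl x = dec-true (x ≟ x) refl

eqb-sound : ∀ {n} {x y : Fin n} → eqb x y ≡ true → x ≡ y
eqb-sound {x = x} {y} = does-sound (x ≟ y)

eqb-≢ : ∀ {n} {x y : Fin n} → x ≢ y → eqb x y ≡ false
eqb-≢ {x = x} {y} = dec-false (x ≟ y)

eqb-complete : ∀ {n} {x y : Fin n} → x ≡ y → eqb x y ≡ true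
eqb-complete {x = x} refl = eqb-refl x

eqb-sym : ∀ {n} (x y : Fin n) → eqb x y ≡ eqb y x
eqb-sym x y with x ≟ y | y ≟ x
... | yes _    | yes _    = refl
... | no _     | no _     = refl
... | yes x≡y  | no y≢x   = ⊥-elim (y≢x (sym x≡y))
... | no x≢y   | yes y≡x  = ⊥-elim (x≢y (sym y≡x))

≤?-true : ∀ {a b} → a ≤ b → does (a ≤? b) ≡ true
≤?-true {a} {b} = dec-true (a ≤? b)

≤?-false : ∀ {a b} → ¬ a ≤ b → does (a ≤? b) ≡ false
≤?-false {a} {b} = dec-false (a ≤? b)

≤?-sound : ∀ {a b} → does (a ≤? b) ≡ true → a ≤ b
≤?-sound {a} {b} = does-sound (a ≤? b)

≤?-refute : ∀ {a b} → does (a ≤? b) ≡ false → ¬ a ≤ b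
≤?-refute {a} {b} = does-refute (a ≤? b)

⁅_⁆ : ∀ {n} → Fin n → VSet n
⁅ a ⁆ x = eqb x a

_∪_ : ∀ {n} → VSet n → VSet n → VSet n
(A ∪ B) x = A x ∨ B x

∁ : ∀ {n} → VSet n → VSet n
∁ A x = not (A x)

_⊆_ : ∀ {n} → VSet n → VSet n → Set
A ⊆ B = ∀ x → A x ≡ true → B x ≡ true

⋁ : ∀ {K} → (Fin K → Bool) → Bool
⋁ = foldr _∨_ false

⋁-intro : ∀ {K} (f : Fin K → Bool) (w : Fin K) → f w ≡ true → ⋁ f ≡ true
⋁-intro f fzero    h = ∨-introˡ _ h
⋁-intro f (fsuc w) h = ∨-introʳ (f fzero) (⋁-intro (λ i → f (fsuc i)) w h)

⋁-false : ∀ {K} (f : Fin K → Bool) → ⋁ f ≡ false → ∀ w → f w ≡ false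
⋁-false f h w with f w in fw
... | false = refl
... | true  = ⊥-elim (true≢false (trans (sym (⋁-intro f w fw)) h))

⋁-none : ∀ {K} (f : Fin K → Bool) → (∀ w → f w ≡ false) → ⋁ f ≡ false
⋁-none {zero}  f h = refl
⋁-none {suc K} f h rewrite h fzero = ⋁-none (λ i → f (fsuc i)) (λ i → h (fsuc i))

𝟙 : Bool → ℕ
𝟙 b = if b then 1 else 0

𝟙-∨ : ∀ a b → 𝟙 (a ∨ b) ≤ 𝟙 a + 𝟙 b
𝟙-∨ true  b = s≤s z≤n
𝟙-∨ false b = ≤-refl

𝟙-≤1 : ∀ a → 𝟙 a ≤ 1
𝟙-≤1 true  = ≤-refl
𝟙-≤1 false = z≤n

sum-mono : ∀ {n} {f g : Fin n → ℕ} → (∀ x → f x ≤ g x) → sum f ≤ sum g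
sum-mono {zero}  h = z≤n
sum-mono {suc n} h = +-mono-≤ (h fzero) (sum-mono (λ i → h (fsuc i)))

sum-bound : ∀ {n} (c : ℕ) {f : Fin n → ℕ} → (∀ x → f x ≤ c) → sum f ≤ n * c
sum-bound {zero}  c h = z≤n
sum-bound {suc n} c h = +-mono-≤ (h fzero) (sum-bound c (λ i → h (fsuc i)))

count-as-sum : ∀ {n} (P : VSet n) → count P ≡ sum (λ x → 𝟙 (P x))
count-as-sum {zero}  P = refl
count-as-sum {suc n} P = cong (𝟙 (P fzero) +_) (count-as-sum (λ i → P (fsuc i)))

count-+ : ∀ {n} (P Q : VSet n) → sum (λ x → 𝟙 (P x) + 𝟙 (Q x)) ≡ count P + count Q
count-+ P Q = trans (∑-distrib-+ (λ x → 𝟙 (P x)) (λ x → 𝟙 (Q x)))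
                    (sym (cong₂ _+_ (count-as-sum P) (count-as-sum Q)))

count-cong : ∀ {n} {P Q : VSet n} → (∀ x → P x ≡ Q x) → count P ≡ count Q
count-cong {P = P} {Q} h =
  trans (count-as-sum P) (trans (sum-cong-≗ (λ x → cong 𝟙 (h x))) (sym (count-as-sum Q)))

count-mono : ∀ {n} {P Q : VSet n} → P ⊆ Q → count P ≤ count Q
count-mono {P = P} {Q} P⊆Q =
  subst₂ _≤_ (sym (count-as-sum P)) (sym (count-as-sum Q)) (sum-mono pointwise)
  where
  pointwise : ∀ x → 𝟙 (P x) ≤ 𝟙 (Q x)
  pointwise x with P x in px
  ... | false = z≤n
  ... | true rewrite P⊆Q x px = ≤-refl

count-none : ∀ {n} (P : VSet n) → (∀ x → P x ≡ false) → count P ≡ 0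
count-none {zero}  P h = refl
count-none {suc n} P h rewrite h fzero = count-none (λ i → P (fsuc i)) (λ i → h (fsuc i))

count-≤-size : ∀ {n} (P : VSet n) → count P ≤ n
count-≤-size {n} P =
  subst₂ _≤_ (sym (count-as-sum P)) (*-identityʳ n) (sum-bound 1 (λ x → 𝟙-≤1 (P x)))

count-singleton : ∀ {n} (a : Fin n) → count ⁅ a ⁆ ≡ 1
count-singleton {suc n} fzero =
  cong suc (count-none {n} (λ i → eqb (fsuc i) fzero) (λ i → eqb-≢ {x = fsuc i} {fzero} λ ()))
count-singleton {suc n} (fsuc a) =
  trans (cong (λ b → 𝟙 b + count (λ i → eqb (fsuc i) (fsuc a))) (eqb-≢ {x = fzero} {fsuc a} λ ()))
        (trans (count-cong (λ i → suc-eqb i a)) (count-singleton a))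
  where
  suc-eqb : ∀ {n} (i a : Fin n) → eqb (fsuc i) (fsuc a) ≡ eqb i a
  suc-eqb i a with i ≟ a
  ... | yes refl = refl
  ... | no _     = refl

count-∪ : ∀ {n} (P Q : VSet n) → count (P ∪ Q) ≤ count P + count Q
count-∪ P Q = subst₂ _≤_ (sym (count-as-sum (P ∪ Q))) (count-+ P Q)
                          (sum-mono (λ x → 𝟙-∨ (P x) (Q x)))

count-cover : ∀ {n} {P : VSet n} (Q Q' : VSet n) → P ⊆ (Q ∪ Q') → count P ≤ count Q + count Q'
count-cover Q Q' P⊆ = ≤-trans (count-mono P⊆) (count-∪ Q Q')

count-disjoint-∪ : ∀ {n} (P Q : VSet n) → (∀ x → P x ≡ true → Q x ≡ false) →
                   count (P ∪ Q) ≡ count P + count Q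
count-disjoint-∪ P Q disjoint =
  trans (count-as-sum (P ∪ Q)) (trans (sum-cong-≗ pointwise) (count-+ P Q))
  where
  pointwise : ∀ x → 𝟙 (P x ∨ Q x) ≡ 𝟙 (P x) + 𝟙 (Q x)
  pointwise x with P x in px
  ... | true rewrite disjoint x px = refl
  ... | false = refl

count-split : ∀ {n} (P Q : VSet n) → count P ≡ count (P ∩ Q) + count (P ∩ ∁ Q)
count-split P Q = trans (count-cong pointwise) (count-disjoint-∪ (P ∩ Q) (P ∩ ∁ Q) disjoint)
  where
  pointwise : ∀ x → P x ≡ ((P ∩ Q) ∪ (P ∩ ∁ Q)) x
  pointwise x with P x | Q x
  ... | true  | true  = refl
  ... | true  | false = refl
  ... | false | _     = refl
  disjoint : ∀ x → (P ∩ Q) x ≡ true → (P ∩ ∁ Q) x ≡ false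
  disjoint x h rewrite ∧-elimʳ {P x} h = 𝔹.∧-zeroʳ (P x)

count-by-parts : ∀ {n K} (part : Fin n → Fin K) (P : VSet n) →
                 count P ≡ sum (λ u → count (λ x → P x ∧ eqb (part x) u))
count-by-parts {n} {K} part P = begin
  count P                                              ≡⟨ count-as-sum P ⟩
  sum (λ x → 𝟙 (P x))                                  ≡⟨ sum-cong-≗ pointwise ⟩
  sum (λ x → sum (λ u → 𝟙 (P x ∧ eqb (part x) u)))     ≡⟨ ∑-comm (λ x u → 𝟙 (P x ∧ eqb (part x) u)) ⟩
  sum (λ u → sum (λ x → 𝟙 (P x ∧ eqb (part x) u)))     ≡⟨ sum-cong-≗ (λ u → sym (count-as-sum (λ x → P x ∧ eqb (part x) u))) ⟩
  sum (λ u → count (λ x → P x ∧ eqb (part x) u))       ∎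
  where
  open ≡-Reasoning
  one-part : (a : Fin K) → sum (λ u → 𝟙 (eqb a u)) ≡ 1
  one-part a = trans (sym (count-as-sum (eqb a)))
                     (trans (count-cong (eqb-sym a)) (count-singleton a))
  pointwise : ∀ x → 𝟙 (P x) ≡ sum (λ u → 𝟙 (P x ∧ eqb (part x) u))
  pointwise x with P x
  ... | true  = sym (one-part (part x))
  ... | false = sym (trans (sym (count-as-sum {K} (λ _ → false))) (count-none {K} (λ _ → false) (λ _ → refl)))

count-⋁ : ∀ {n K} (B : Fin K → VSet n) → count (λ x → ⋁ (λ w → B w x)) ≤ sum (λ w → count (B w))
count-⋁ {n} {K} B = begin
  count (λ x → ⋁ (λ w → B w x))           ≡⟨ count-as-sum (λ x → ⋁ (λ w → B w x)) ⟩
  sum (λ x → 𝟙 (⋁ (λ w → B w x)))         ≤⟨ sum-mono (λ x → 𝟙-⋁ (λ w → B w x)) ⟩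
  sum (λ x → sum (λ w → 𝟙 (B w x)))       ≡⟨ ∑-comm (λ x w → 𝟙 (B w x)) ⟩
  sum (λ w → sum (λ x → 𝟙 (B w x)))       ≡⟨ sum-cong-≗ (λ w → sym (count-as-sum (B w))) ⟩
  sum (λ w → count (B w))                 ∎
  where
  open ≤-Reasoning
  𝟙-⋁ : ∀ {K} (f : Fin K → Bool) → 𝟙 (⋁ f) ≤ sum (λ w → 𝟙 (f w))
  𝟙-⋁ {zero}  f = z≤n
  𝟙-⋁ {suc K} f = ≤-trans (𝟙-∨ (f fzero) _) (+-monoʳ-≤ (𝟙 (f fzero)) (𝟙-⋁ (λ i → f (fsuc i))))

find : ∀ {n} (P : VSet n) → (∃ λ x → P x ≡ true) ⊎ (∀ x → P x ≡ false)
find {zero}  P = inj₂ (λ ())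
find {suc n} P with P fzero in p0 | find (λ i → P (fsuc i))
... | true  | _              = inj₁ (fzero , p0)
... | false | inj₁ (i , pi)  = inj₁ (fsuc i , pi)
... | false | inj₂ none      = inj₂ λ { fzero → p0 ; (fsuc i) → none i }

remove-self : ∀ {n} (W : VSet n) (v : Fin n) → remove W v v ≡ false
remove-self W v rewrite eqb-refl v = 𝔹.∧-zeroʳ (W v)

remove-other : ∀ {n} (W : VSet n) {v y : Fin n} → y ≢ v → remove W v y ≡ W y
remove-other W {v} {y} y≢v rewrite eqb-≢ y≢v = 𝔹.∧-identityʳ (W y)

remove-⊆ : ∀ {n} (W : VSet n) (v : Fin n) → remove W v ⊆ W
remove-⊆ W v y = ∧-elimˡ {W y}

join-away : ∀ {n} (F : Adj n) {v : Fin n} (T : VSet n) {x y : Fin n} → x ≢ v → y ≢ v →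
            joinTo F v T x y ≡ F x y
join-away F T {x} {y} x≢v y≢v rewrite eqb-≢ x≢v | eqb-≢ y≢v = 𝔹.∨-identityʳ (F x y)

join-from : ∀ {n} (F : Adj n) {v : Fin n} (T : VSet n) {y : Fin n} → y ≢ v →
            joinTo F v T v y ≡ (F v y ∨ T y)
join-from F {v} T {y} y≢v rewrite eqb-refl v | eqb-≢ y≢v = cong (F v y ∨_) (𝔹.∨-identityʳ (T y))

join-to : ∀ {n} (F : Adj n) {v : Fin n} (T : VSet n) {x : Fin n} → x ≢ v →
          joinTo F v T x v ≡ (F x v ∨ T x)
join-to F {v} T {x} x≢v rewrite eqb-refl v | eqb-≢ x≢v = refl

join-loop : ∀ {n} (F : Adj n) {v : Fin n} (T : VSet n) → T v ≡ false → joinTo F v T v v ≡ F v v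
join-loop F {v} T T-v rewrite eqb-refl v | T-v = 𝔹.∨-identityʳ (F v v)

join-value : ∀ {f s w e : Bool} → f ≡ (not w ∧ e) → (w ≡ true → s ≡ e) → (f ∨ (s ∧ w)) ≡ e
join-value {w = true}  {e} refl s≡e rewrite s≡e refl = 𝔹.∧-identityʳ e
join-value {s = s} {w = false} {e} refl _ rewrite 𝔹.∧-zeroʳ s = 𝔹.∨-identityʳ e

majority-arith : ∀ d l h → (4 * d + 1) * h ≤ 2 * d * (l + h) → l + h ≤ 2 * l
majority-arith d l h le = subst (l + h ≤_) (+-*-Solver.solve 1 (λ l → l :+ l := con 2 :* l) refl l)
                                (+-monoʳ-≤ l h≤l)
  where
  open +-*-Solver
  small : (1 + 2 * d) * h ≤ 2 * d * l
  small = +-cancelʳ-≤ (2 * d * h) _ _ (subst₂ _≤_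
    (solve 2 (λ d h → (con 4 :* d :+ con 1) :* h := (con 1 :+ con 2 :* d) :* h :+ con 2 :* d :* h) refl d h)
    (solve 3 (λ d l h → con 2 :* d :* (l :+ h) := con 2 :* d :* l :+ con 2 :* d :* h) refl d l h) le)
  h≤l : h ≤ l
  h≤l = *-cancelˡ-≤ (1 + 2 * d) (≤-trans small (*-monoˡ-≤ l (n≤1+n (2 * d))))

almost-complete-arith : ∀ (m q c d t : ℕ) → m * q ≤ 2 * d * (m + q) + c * m →
                        c + 2 * d + t ≤ q → m * t ≤ 2 * d * (c + 2 * d + t)
almost-complete-arith m q c d t h s≤q with m≤n⇒∃[o]m+o≡n s≤q
... | e , refl with m ≤? 2 * d
...   | yes m≤2d = ≤-trans (*-monoˡ-≤ t m≤2d) (*-monoʳ-≤ (2 * d) (m≤n+m t (c + 2 * d)))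
...   | no m>2d = +-cancelʳ-≤ (m * e) (m * t) (2 * d * s)
                    (≤-trans without-cm (+-monoʳ-≤ (2 * d * s) (*-monoˡ-≤ e (≰⇒≥ m>2d))))
  where
  open +-*-Solver
  s = c + 2 * d + t
  expanded : (m * t + m * e) + (c * m + 2 * d * m) ≤ (2 * d * s + 2 * d * e) + (c * m + 2 * d * m)
  expanded = subst₂ _≤_
    (solve 5 (λ m c d t e → m :* (c :+ con 2 :* d :+ t :+ e)
                          := (m :* t :+ m :* e) :+ (c :* m :+ con 2 :* d :* m)) refl m c d t e)
    (solve 5 (λ m c d t e → con 2 :* d :* (m :+ (c :+ con 2 :* d :+ t :+ e)) :+ c :* m
                          := (con 2 :* d :* (c :+ con 2 :* d :+ t) :+ con 2 :* d :* e)
                             :+ (c :* m :+ con 2 :* d :* m)) refl m c d t e)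
    h
  without-cm : m * t + m * e ≤ 2 * d * s + 2 * d * e
  without-cm = +-cancelʳ-≤ (c * m + 2 * d * m) _ _ expanded

-- Degenerate graphs have few edges in every induced subgraph; the two
-- consequences used later are that a majority of the vertices of any set
-- have low degree inside it, and that few vertices can be adjacent to
-- almost all of a large set.
module DegenerateGraph {n : ℕ} {G : Adj n} (G-simple : IsSimpleGraph G)
                       {d : ℕ} (G-degenerate : Degenerate d G) where

  private
    σ = proj₁ G-degenerate
    σ-injective = proj₁ (proj₂ G-degenerate)
    back-degree-≤ = proj₂ (proj₂ G-degenerate)

  -- y precedes x in the degeneracy ordering.
  precedes : Fin n → Fin n → Bool
  precedes x y = does (σ y <? σ x)

  -- The degree of x in G[A], taken to be 0 when x ∉ A.
  innerDegree : VSet n → Fin n → ℕ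
  innerDegree A x = count (λ y → A x ∧ A y ∧ G x y)

  back-edges : VSet n → Fin n → ℕ
  back-edges A x = count (λ y → (A x ∧ A y ∧ G x y) ∧ precedes x y)

  back-edges-≤ : (A : VSet n) (x : Fin n) → back-edges A x ≤ d * 𝟙 (A x)
  back-edges-≤ A x with A x
  ... | true  = ≤-trans (count-mono forget-A)
                  (≤-trans (back-degree-≤ x) (≤-reflexive (sym (*-identityʳ d))))
    where
    forget-A : ∀ y → ((A y ∧ G x y) ∧ precedes x y) ≡ true → (G x y ∧ precedes x y) ≡ true
    forget-A y h with A y
    ... | true = h
  ... | false = subst (_≤ d * 0) (sym (count-none {n} _ (λ _ → refl))) z≤n

  sum-back-edges : (A : VSet n) → sum (back-edges A) ≤ d * count A
  sum-back-edges A = begin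
    sum (back-edges A)              ≤⟨ sum-mono (back-edges-≤ A) ⟩
    sum (λ x → d * 𝟙 (A x))         ≡⟨ sym (*-distribˡ-sum d (λ x → 𝟙 (A x))) ⟩
    d * sum (λ x → 𝟙 (A x))         ≡⟨ cong (d *_) (sym (count-as-sum A)) ⟩
    d * count A                     ∎
    where open ≤-Reasoning

  reverse-edge : (A : VSet n) (x y : Fin n) → ((A x ∧ A y ∧ G x y) ∧ not (precedes x y)) ≡ true →
                 ((A y ∧ A x ∧ G y x) ∧ precedes y x) ≡ true
  reverse-edge A x y h =
    ∧-intro (∧-intro Ay (∧-intro Ax Gyx)) (dec-true (σ x <? σ y) σx<σy)
    where
    edge = ∧-elimˡ {A x ∧ A y ∧ G x y} h
    Ax = ∧-elimˡ {A x} edge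
    Ay = ∧-elimˡ {A y} (∧-elimʳ {A x} edge)
    Gxy = ∧-elimʳ {A y} (∧-elimʳ {A x} edge)
    Gyx = trans (IsSimpleGraph.symmetric G-simple y x) Gxy
    x≢y : x ≢ y
    x≢y refl = true≢false (trans (sym Gxy) (IsSimpleGraph.irreflexive G-simple x))
    σx<σy : σ x Data.Fin.< σ y
    σx<σy = ≤∧≢⇒< (≮⇒≥ (does-refute (σ y <? σ x) (not-true (∧-elimʳ {A x ∧ A y ∧ G x y} h))))
                   (λ e → x≢y (σ-injective (FinP.toℕ-injective e)))

  degree-sum : (A : VSet n) → sum (innerDegree A) ≤ 2 * d * count A
  degree-sum A = begin
    sum (innerDegree A)
      ≡⟨ sum-cong-≗ (λ x → count-split (λ y → A x ∧ A y ∧ G x y) (precedes x)) ⟩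
    sum (λ x → back-edges A x + forward-edges x)
      ≡⟨ ∑-distrib-+ (back-edges A) forward-edges ⟩
    sum (back-edges A) + sum forward-edges
      ≤⟨ +-mono-≤ (sum-back-edges A) forward-bound ⟩
    d * count A + d * count A
      ≡⟨ +-*-Solver.solve 2 (λ d c → d :* c :+ d :* c := con 2 :* d :* c) refl d (count A) ⟩
    2 * d * count A ∎
    where
    open ≤-Reasoning
    open +-*-Solver using (_:+_; _:*_; _:=_; con)
    forward-edges : Fin n → ℕ
    forward-edges x = count (λ y → (A x ∧ A y ∧ G x y) ∧ not (precedes x y))
    back-edge-at : Fin n → Fin n → Bool
    back-edge-at y x = (A y ∧ A x ∧ G y x) ∧ precedes y x
    forward-bound : sum forward-edges ≤ d * count A
    forward-bound = begin
      sum forward-edges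
        ≤⟨ sum-mono (λ x → count-mono (reverse-edge A x)) ⟩
      sum (λ x → count (λ y → back-edge-at y x))
        ≡⟨ sum-cong-≗ (λ x → count-as-sum (λ y → back-edge-at y x)) ⟩
      sum (λ x → sum (λ y → 𝟙 (back-edge-at y x)))
        ≡⟨ ∑-comm (λ x y → 𝟙 (back-edge-at y x)) ⟩
      sum (λ y → sum (λ x → 𝟙 (back-edge-at y x)))
        ≡⟨ sum-cong-≗ (λ y → sym (count-as-sum (back-edge-at y))) ⟩
      sum (back-edges A)
        ≤⟨ sum-back-edges A ⟩
      d * count A ∎

  neighboursIn : VSet n → Fin n → VSet n
  neighboursIn A y z = A z ∧ G y z

  degreeIn : VSet n → Fin n → ℕ
  degreeIn A y = count (neighboursIn A y)

  lowDegree : VSet n → VSet n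
  lowDegree A y = A y ∧ does (degreeIn A y ≤? 4 * d)

  lowDegree-majority : (A : VSet n) → count A ≤ 2 * count (lowDegree A)
  lowDegree-majority A =
    subst (_≤ 2 * count (lowDegree A)) (sym (count-split A isLow))
          (majority-arith d (count (lowDegree A)) (count high) high-bound)
    where
    isLow : VSet n
    isLow y = does (degreeIn A y ≤? 4 * d)
    high : VSet n
    high = A ∩ ∁ isLow
    high-degree : ∀ x → (4 * d + 1) * 𝟙 (high x) ≤ innerDegree A x
    high-degree x with A x | isLow x in low?
    ... | false | _     = ≤-trans (≤-reflexive (*-zeroʳ (4 * d + 1))) z≤n
    ... | true  | true  = ≤-trans (≤-reflexive (*-zeroʳ (4 * d + 1))) z≤n
    ... | true  | false = subst (_≤ degreeIn A x) (sym (*-identityʳ (4 * d + 1)))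
                            (subst (_≤ degreeIn A x) (+-comm 1 (4 * d)) (≰⇒> (≤?-refute low?)))
    high-bound : (4 * d + 1) * count high ≤ 2 * d * (count (lowDegree A) + count high)
    high-bound = begin
      (4 * d + 1) * count high                   ≡⟨ cong ((4 * d + 1) *_) (count-as-sum high) ⟩
      (4 * d + 1) * sum (λ x → 𝟙 (high x))       ≡⟨ *-distribˡ-sum (4 * d + 1) (λ x → 𝟙 (high x)) ⟩
      sum (λ x → (4 * d + 1) * 𝟙 (high x))       ≤⟨ sum-mono high-degree ⟩
      sum (innerDegree A)                        ≤⟨ degree-sum A ⟩
      2 * d * count A                            ≡⟨ cong (2 * d *_) (count-split A isLow) ⟩
      2 * d * (count (lowDegree A) + count high) ∎
      where open ≤-Reasoning

  almost-complete-bound : (c t : ℕ) (X P : VSet n) →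
    (∀ x → X x ≡ true → count (λ y → P y ∧ not (G x y)) ≤ c) →
    c + 2 * d + t ≤ count P → count X * t ≤ 2 * d * (c + 2 * d + t)
  almost-complete-bound c t X P few-misses large =
    almost-complete-arith (count X) (count P) c d t edges-vs-misses large
    where
    A = X ∪ P
    q = count P
    degree-in-A : ∀ x → q * 𝟙 (X x) ≤ innerDegree A x + c * 𝟙 (X x)
    degree-in-A x with X x in x∈X
    ... | false = ≤-trans (≤-reflexive (*-zeroʳ q)) z≤n
    ... | true  = subst₂ _≤_ (sym (*-identityʳ q)) (cong (degreeIn A x +_) (sym (*-identityʳ c)))
        (≤-trans (≤-reflexive (count-split P (G x)))
                 (+-mono-≤ (count-mono P∩N⊆) (few-misses x x∈X)))
      where
      P∩N⊆ : ∀ y → (P y ∧ G x y) ≡ true → ((X y ∨ P y) ∧ G x y) ≡ true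
      P∩N⊆ y h with X y | P y
      ... | true  | _    = ∧-elimʳ h
      ... | false | true = h
    edges-vs-misses : count X * q ≤ 2 * d * (count X + q) + c * count X
    edges-vs-misses = begin
      count X * q                                       ≡⟨ *-comm (count X) q ⟩
      q * count X                                       ≡⟨ cong (q *_) (count-as-sum X) ⟩
      q * sum (λ x → 𝟙 (X x))                           ≡⟨ *-distribˡ-sum q (λ x → 𝟙 (X x)) ⟩
      sum (λ x → q * 𝟙 (X x))                           ≤⟨ sum-mono degree-in-A ⟩
      sum (λ x → innerDegree A x + c * 𝟙 (X x))         ≡⟨ ∑-distrib-+ (innerDegree A) (λ x → c * 𝟙 (X x)) ⟩
      sum (innerDegree A) + sum (λ x → c * 𝟙 (X x))     ≤⟨ +-mono-≤ (degree-sum A) (≤-reflexive c-term) ⟩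
      2 * d * count A + c * count X                     ≤⟨ +-monoˡ-≤ (c * count X) (*-monoʳ-≤ (2 * d) (count-∪ X P)) ⟩
      2 * d * (count X + q) + c * count X               ∎
      where
      open ≤-Reasoning
      c-term : sum (λ x → c * 𝟙 (X x)) ≡ c * count X
      c-term = trans (sym (*-distribˡ-sum c (λ x → 𝟙 (X x)))) (cong (c *_) (sym (count-as-sum X)))

module Bounds (K d : ℕ) .{{K≢0 : NonZero K}} .{{d≢0 : NonZero d}} where

  open +-*-Solver

  -- the similarity threshold and the matching threshold of the procedure
  c₀ c₁ : ℕ
  c₀ = 160 * d * K ^ 3
  c₁ = 1140 * d * K ^ 4

  -- a new set S_k agrees with a row of R outside at most α vertices
  α : ℕ
  α = 2 * c₀ + 4 * d + 1

  -- a removed vertex is "bad" for a part if it misses at most γ of its vertices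
  γ : ℕ
  γ = 1 + α + c₁

  -- parts of size at most β are "small"; there are at most μ bad vertices per large part
  τ β μ : ℕ
  τ = 300 * d * K ^ 4
  β = γ + 2 * d + τ
  μ = 12 * d

  dK : ℕ → ℕ
  dK i = d * K ^ i

  dK-mono : ∀ {i j} → i ≤ j → dK i ≤ dK j
  dK-mono i≤j = *-monoʳ-≤ d (^-monoʳ-≤ K i≤j)

  d≤dK : ∀ i → d ≤ dK i
  d≤dK i = subst (_≤ dK i) (*-identityʳ d) (dK-mono {0} {i} z≤n)

  1≤dK : ∀ i → 1 ≤ dK i
  1≤dK i = ≤-trans (>-nonZero⁻¹ d) (d≤dK i)

  K≤dK : ∀ i → 1 ≤ i → K ≤ dK i
  K≤dK i 1≤i = ≤-trans (≤-trans (≤-reflexive (sym (*-identityʳ K))) (m≤n*m (K ^ 1) d)) (dK-mono {1} {i} 1≤i)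

  scale : ∀ a i j → i ≤ j → a * dK i ≤ a * dK j
  scale a i j i≤j = *-monoʳ-≤ a (dK-mono {i} {j} i≤j)

  -- Two low-degree neighbourhoods (plus the two vertices themselves) fit in c₀.
  low-pair-≤-c₀ : ∀ {a b} → a ≤ 4 * d → b ≤ 4 * d → 1 + (1 + (a + b)) ≤ c₀
  low-pair-≤-c₀ {a} {b} a≤ b≤ = begin
    1 + (1 + (a + b))          ≤⟨ +-monoʳ-≤ 1 (+-monoʳ-≤ 1 (+-mono-≤ a≤ b≤)) ⟩
    1 + (1 + (4 * d + 4 * d))  ≡⟨ solve 1 (λ d → con 1 :+ (con 1 :+ (con 4 :* d :+ con 4 :* d))
                                             := con 2 :+ con 8 :* d) refl d ⟩
    2 + 8 * d                  ≤⟨ +-monoˡ-≤ (8 * d) (*-monoʳ-≤ 2 (>-nonZero⁻¹ d)) ⟩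
    2 * d + 8 * d              ≤⟨ m≤m+n (2 * d + 8 * d) (150 * d) ⟩
    2 * d + 8 * d + 150 * d    ≡⟨ solve 1 (λ d → con 2 :* d :+ con 8 :* d :+ con 150 :* d
                                             := con 160 :* d :* con 1) refl d ⟩
    160 * d * 1                ≤⟨ *-monoʳ-≤ (160 * d) (m^n>0 K 3) ⟩
    c₀                         ∎
    where open ≤-Reasoning

  -- The vertices of W outnumber what a vertex of similarity-degree ≤ 4dK could account for.
  threshold-beats-similarity : 2 * (K * (K * (4 * d) + 1)) < 1100 * d * K ^ 5
  threshold-beats-similarity = begin-strict
    2 * (K * (K * (4 * d) + 1)) ≡⟨ solve 2 (λ K d → con 2 :* (K :* (K :* (con 4 :* d) :+ con 1))
                                                  := con 8 :* (d :* K :^ 2) :+ con 2 :* K) refl K d ⟩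
    8 * dK 2 + 2 * K            ≤⟨ +-mono-≤ (scale 8 2 5 (s≤s (s≤s z≤n))) (*-monoʳ-≤ 2 (K≤dK 5 (s≤s z≤n))) ⟩
    8 * dK 5 + 2 * dK 5         ≡⟨ solve 1 (λ X → con 8 :* X :+ con 2 :* X := con 10 :* X) refl (dK 5) ⟩
    10 * dK 5                   <⟨ *-monoˡ-< (dK 5) {{>-nonZero (1≤dK 5)}} (s≤s (m≤m+n 10 1089)) ⟩
    1100 * dK 5                 ≡⟨ sym (*-assoc 1100 d (K ^ 5)) ⟩
    1100 * d * K ^ 5            ∎
    where open ≤-Reasoning

  -- Two exceptional sets together stay within the matching threshold.
  α+α≤c₁ : α + α ≤ c₁
  α+α≤c₁ = begin
    α + α                       ≡⟨ solve 2 (λ d K → let c = con 160 :* d :* K :^ 3 in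
                                              (con 2 :* c :+ con 4 :* d :+ con 1) :+ (con 2 :* c :+ con 4 :* d :+ con 1)
                                              := con 640 :* (d :* K :^ 3) :+ con 8 :* d :+ con 2) refl d K ⟩
    640 * dK 3 + 8 * d + 2      ≤⟨ +-mono-≤ (+-monoʳ-≤ (640 * dK 3) (*-monoʳ-≤ 8 (d≤dK 3))) (*-monoʳ-≤ 2 (1≤dK 3)) ⟩
    640 * dK 3 + 8 * dK 3 + 2 * dK 3
                                ≡⟨ solve 1 (λ X → con 640 :* X :+ con 8 :* X :+ con 2 :* X := con 650 :* X) refl (dK 3) ⟩
    650 * dK 3                  ≤⟨ scale 650 3 4 (n≤1+n 3) ⟩
    650 * dK 4                  ≤⟨ *-monoˡ-≤ (dK 4) (m≤m+n 650 490) ⟩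
    1140 * dK 4                 ≡⟨ sym (*-assoc 1140 d (K ^ 4)) ⟩
    c₁                          ∎
    where open ≤-Reasoning

  -- For c = c₀: a set of size > α is large enough for the almost-complete bound
  -- with c₀ + 1 misses, and that bound then reads |X| ≤ 4d.
  α-split : ∀ c → 1 + (2 * c + 4 * d + 1) ≡ (1 + c) + 2 * d + (1 + (c + 2 * d))
  α-split c = solve 2 (λ c d → con 1 :+ (con 2 :* c :+ con 4 :* d :+ con 1)
                             := (con 1 :+ c) :+ con 2 :* d :+ (con 1 :+ (c :+ con 2 :* d))) refl c d

  α-bound : ∀ c → 2 * d * ((1 + c) + 2 * d + (1 + (c + 2 * d))) ≡ 4 * d * (1 + (c + 2 * d))
  α-bound c = solve 2 (λ c d → con 2 :* d :* ((con 1 :+ c) :+ con 2 :* d :+ (con 1 :+ (c :+ con 2 :* d)))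
                             := con 4 :* d :* (con 1 :+ (c :+ con 2 :* d))) refl c d

  -- β is at most 6τ, which makes the almost-complete bound give μ bad vertices per part.
  β≤6τ : β ≤ 6 * τ
  β≤6τ = begin
    β                                ≡⟨ solve 2 (λ d K → let c = con 160 :* d :* K :^ 3 in
                                          con 1 :+ (con 2 :* c :+ con 4 :* d :+ con 1) :+ con 1140 :* d :* K :^ 4
                                            :+ con 2 :* d :+ con 300 :* d :* K :^ 4
                                          := con 2 :+ con 6 :* d :+ con 320 :* (d :* K :^ 3) :+ con 1440 :* (d :* K :^ 4))
                                        refl d K ⟩
    2 + 6 * d + 320 * dK 3 + 1440 * dK 4
                                     ≤⟨ +-monoˡ-≤ (1440 * dK 4) (+-mono-≤ (+-mono-≤ (*-monoʳ-≤ 2 (1≤dK 4)) (*-monoʳ-≤ 6 (d≤dK 4)))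
                                                                       (scale 320 3 4 (n≤1+n 3))) ⟩
    2 * dK 4 + 6 * dK 4 + 320 * dK 4 + 1440 * dK 4
                                     ≤⟨ m≤m+n _ (32 * dK 4) ⟩
    2 * dK 4 + 6 * dK 4 + 320 * dK 4 + 1440 * dK 4 + 32 * dK 4
                                     ≡⟨ solve 1 (λ X → con 2 :* X :+ con 6 :* X :+ con 320 :* X :+ con 1440 :* X :+ con 32 :* X
                                                      := con 6 :* (con 300 :* X)) refl (dK 4) ⟩
    6 * (300 * dK 4)                 ≡⟨ cong (6 *_) (sym (*-assoc 300 d (K ^ 4))) ⟩
    6 * τ                            ∎
    where open ≤-Reasoning

  2dβ≤μτ : 2 * d * β ≤ μ * τ
  2dβ≤μτ = ≤-trans (*-monoʳ-≤ (2 * d) β≤6τ)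
                   (≤-reflexive (solve 2 (λ d t → con 2 :* d :* (con 6 :* t) := con 12 :* d :* t) refl d τ))

  instance
    τ≢0 : NonZero τ
    τ≢0 = >-nonZero (subst (1 ≤_) (sym (*-assoc 300 d (K ^ 4))) (≤-trans (1≤dK 4) (m≤n*m (dK 4) 300)))

  -- All the vertices set aside by the analysis, plus the final W, number at most 4000dK⁶.
  final-budget : α * K + (K * β + K * μ) + 1100 * d * K ^ 5 ≤ 4000 * d * K ^ 6
  final-budget = begin
    α * K + (K * β + K * μ) + 1100 * d * K ^ 5
      ≡⟨ solve 2 (λ d K → let c = con 160 :* d :* K :^ 3
                              a = con 2 :* c :+ con 4 :* d :+ con 1
                              b = con 1 :+ a :+ con 1140 :* d :* K :^ 4 :+ con 2 :* d :+ con 300 :* d :* K :^ 4 in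
                  a :* K :+ (K :* b :+ K :* (con 12 :* d)) :+ con 1100 :* d :* K :^ 5
                  := con 2540 :* (d :* K :^ 5) :+ con 640 :* (d :* K :^ 4) :+ con 22 :* (d :* K :^ 1) :+ con 3 :* K)
                refl d K ⟩
    2540 * dK 5 + 640 * dK 4 + 22 * dK 1 + 3 * K
      ≤⟨ +-mono-≤ (+-mono-≤ (+-mono-≤ (scale 2540 5 6 (n≤1+n 5)) (scale 640 4 6 (m≤n+m 4 2))) (scale 22 1 6 (s≤s z≤n)))
                  (*-monoʳ-≤ 3 (K≤dK 6 (s≤s z≤n))) ⟩
    2540 * dK 6 + 640 * dK 6 + 22 * dK 6 + 3 * dK 6
      ≤⟨ m≤m+n _ (795 * dK 6) ⟩
    2540 * dK 6 + 640 * dK 6 + 22 * dK 6 + 3 * dK 6 + 795 * dK 6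
      ≡⟨ solve 1 (λ X → con 2540 :* X :+ con 640 :* X :+ con 22 :* X :+ con 3 :* X :+ con 795 :* X
                      := con 4000 :* X) refl (dK 6) ⟩
    4000 * dK 6
      ≡⟨ sym (*-assoc 4000 d (K ^ 6)) ⟩
    4000 * d * K ^ 6 ∎
    where open ≤-Reasoning

-- The analysis of the procedure run on H = G^R.
module Analysis {K : ℕ} (R : Adj K) (R-symmetric : ∀ u v → R u v ≡ R v u)
                {n : ℕ} {G : Adj n} (G-simple : IsSimpleGraph G)
                {d : ℕ} (G-degenerate : Degenerate d G) (part : Fin n → Fin K)
                .{{K≢0 : NonZero K}} .{{d≢0 : NonZero d}} where

  open DegenerateGraph G-simple G-degenerate
  open Bounds K d

  H E : Adj n
  H = flipR R part G
  E = flipR R part edgeless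

  open Procedure H d K

  N : VSet n → Fin n → VSet n
  N = nbhdIn H

  N-off-diagonal : ∀ W {x y} → x ≢ y → N W x y ≡ (W y ∧ (G x y xor R (part x) (part y)))
  N-off-diagonal W {x} {y} x≢y rewrite eqb-≢ x≢y = refl

  E-off-diagonal : ∀ {x y} → x ≢ y → E x y ≡ R (part x) (part y)
  E-off-diagonal {x} {y} x≢y rewrite eqb-≢ x≢y = refl

  E-diagonal : ∀ x → E x x ≡ false
  E-diagonal x rewrite eqb-refl x = refl

  inPart : Fin K → VSet n
  inPart u y = eqb (part y) u

  partOf : VSet n → Fin K → VSet n
  partOf W u = W ∩ inPart u

  similar : VSet n → Fin n → VSet n
  similar W v w = W w ∧ not (eqb w v) ∧ does (symDiffSize (N W v) (N W w) ≤? c₀)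

  similarityDegree : VSet n → Fin n → ℕ
  similarityDegree = simDegree c₀ H

  similar-≤-c₀ : ∀ W v w → similar W v w ≡ true → symDiffSize (N W v) (N W w) ≤ c₀
  similar-≤-c₀ W v w h = ≤?-sound (∧-elimʳ {not (eqb w v)} (∧-elimʳ {W w} h))

  Maximiser : VSet n → Fin n → Set
  Maximiser W v = ∀ w → W w ≡ true → similarityDegree W w ≤ similarityDegree W v

  flip-cancels : ∀ w g₀ g₁ r → ((w ∧ (g₀ xor r)) xor (w ∧ (g₁ xor r))) ≡ true →
                 ((w ∧ g₀) ∨ (w ∧ g₁)) ≡ true
  flip-cancels true  true  false r _ = refl
  flip-cancels true  false true  r _ = refl
  flip-cancels true  true  true  true  ()
  flip-cancels true  true  true  false ()
  flip-cancels true  false false true  ()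
  flip-cancels true  false false false ()
  flip-cancels false g₀ g₁ r ()

  same-part-difference : ∀ W {x₀ x} → part x₀ ≡ part x →
    (λ y → N W x₀ y xor N W x y) ⊆ (⁅ x₀ ⁆ ∪ (⁅ x ⁆ ∪ (neighboursIn W x₀ ∪ neighboursIn W x)))
  same-part-difference W {x₀} {x} same y h with y ≟ x₀ | y ≟ x
  ... | yes _   | _       = refl
  ... | no _    | yes _   = refl
  ... | no y≢x₀ | no y≢x  = flip-cancels (W y) (G x₀ y) (G x y) (R (part x) (part y))
      (subst (_≡ true) (cong₂ _xor_
        (trans (N-off-diagonal W (y≢x₀ ∘ sym)) (cong (λ p → W y ∧ (G x₀ y xor R p (part y))) same))
        (N-off-diagonal W (y≢x ∘ sym))) h)

  low-degree-similar : ∀ W {x₀ x} → part x₀ ≡ part x →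
    degreeIn W x₀ ≤ 4 * d → degreeIn W x ≤ 4 * d → symDiffSize (N W x₀) (N W x) ≤ c₀
  low-degree-similar W {x₀} {x} same low₀ low = begin
    symDiffSize (N W x₀) (N W x)
      ≤⟨ count-cover ⁅ x₀ ⁆ (⁅ x ⁆ ∪ (neighboursIn W x₀ ∪ neighboursIn W x)) (same-part-difference W same) ⟩
    count ⁅ x₀ ⁆ + count (⁅ x ⁆ ∪ (neighboursIn W x₀ ∪ neighboursIn W x))
      ≤⟨ +-monoʳ-≤ (count ⁅ x₀ ⁆) (≤-trans (count-∪ ⁅ x ⁆ (neighboursIn W x₀ ∪ neighboursIn W x))
                                           (+-monoʳ-≤ (count ⁅ x ⁆) (count-∪ (neighboursIn W x₀) (neighboursIn W x)))) ⟩
    count ⁅ x₀ ⁆ + (count ⁅ x ⁆ + (degreeIn W x₀ + degreeIn W x))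
      ≡⟨ cong₂ (λ a b → a + (b + (degreeIn W x₀ + degreeIn W x))) (count-singleton x₀) (count-singleton x) ⟩
    1 + (1 + (degreeIn W x₀ + degreeIn W x))
      ≤⟨ low-pair-≤-c₀ low₀ low ⟩
    c₀ ∎
    where open ≤-Reasoning

  lowDegree-per-part : ∀ W v → Maximiser W v → ∀ u →
    count (lowDegree W ∩ inPart u) ≤ similarityDegree W v + 1
  lowDegree-per-part W v max u with find (lowDegree W ∩ inPart u)
  ... | inj₂ none = subst (_≤ similarityDegree W v + 1) (sym (count-none _ none)) z≤n
  ... | inj₁ (x₀ , x₀∈) = begin
    count (lowDegree W ∩ inPart u)                      ≤⟨ count-cover ⁅ x₀ ⁆ (similar W x₀) covered ⟩
    count ⁅ x₀ ⁆ + similarityDegree W x₀                ≡⟨ cong (_+ similarityDegree W x₀) (count-singleton x₀) ⟩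
    1 + similarityDegree W x₀                           ≤⟨ +-monoʳ-≤ 1 (max x₀ W-x₀) ⟩
    1 + similarityDegree W v                            ≡⟨ +-comm 1 (similarityDegree W v) ⟩
    similarityDegree W v + 1                            ∎
    where
    open ≤-Reasoning
    low₀ = ∧-elimˡ {lowDegree W x₀} x₀∈
    W-x₀ = ∧-elimˡ {W x₀} low₀
    part-x₀ = eqb-sound (∧-elimʳ {lowDegree W x₀} x₀∈)
    covered : (lowDegree W ∩ inPart u) ⊆ (⁅ x₀ ⁆ ∪ similar W x₀)
    covered y y∈ with y ≟ x₀
    ... | yes _   = refl
    ... | no _ = ∧-intro W-y (≤?-true
          (low-degree-similar W (trans part-x₀ (sym (eqb-sound (∧-elimʳ {lowDegree W y} y∈))))
             (≤?-sound (∧-elimʳ {W x₀} low₀)) (≤?-sound (∧-elimʳ {W y} (∧-elimˡ {lowDegree W y} y∈)))))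
      where
      W-y = ∧-elimˡ {W y} (∧-elimˡ {lowDegree W y} y∈)

  lowDegree-count : ∀ W v → Maximiser W v → count (lowDegree W) ≤ K * (similarityDegree W v + 1)
  lowDegree-count W v max = subst (_≤ K * (similarityDegree W v + 1)) (sym (count-by-parts part (lowDegree W)))
                                  (sum-bound _ (lowDegree-per-part W v max))

  deviation : VSet n → Fin n → Fin K → VSet n
  deviation W v u y = N W v y xor (W y ∧ R u (part y))

  deviation-at-non-neighbour : ∀ a w g r → ((a xor (w ∧ r)) ∧ not g) ≡ true → (a xor (w ∧ (g xor r))) ≡ true
  deviation-at-non-neighbour a w false r h = trans (cong (λ b → a xor (w ∧ b)) (𝔹.xor-identityˡ r))
                                                  (trans (sym (𝔹.∧-identityʳ _)) h)
  deviation-at-non-neighbour a w true r h = ⊥-elim (true≢false (trans (sym h) (𝔹.∧-zeroʳ _)))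

  deviation-misses : ∀ W v u {x} → part x ≡ u →
    (deviation W v u ∩ ∁ (G x)) ⊆ (⁅ x ⁆ ∪ (λ y → N W v y xor N W x y))
  deviation-misses W v u {x} part-x y h with y ≟ x
  ... | yes _  = refl
  ... | no y≢x = subst (λ b → (N W v y xor b) ≡ true)
      (sym (trans (N-off-diagonal W (λ e → y≢x (sym e))) (cong (λ p → W y ∧ (G x y xor R p (part y))) part-x)))
      (deviation-at-non-neighbour (N W v y) (W y) (G x y) (R u (part y)) h)

  -- If N(v) is far from row u, then v is similar to at most 4d vertices of
  -- part u: each of them is adjacent in G to almost all of the deviation set.
  few-similar-in-far-part : ∀ W v u → α < count (deviation W v u) →
    count (similar W v ∩ inPart u) ≤ 4 * d
  few-similar-in-far-part W v u far = *-cancelʳ-≤ (count X) (4 * d) (suc (c₀ + 2 * d))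
    (subst (count X * suc (c₀ + 2 * d) ≤_) (α-bound c₀)
      (almost-complete-bound (suc c₀) (suc (c₀ + 2 * d)) X (deviation W v u) few-misses
        (subst (_≤ count (deviation W v u)) (α-split c₀) far)))
    where
    X = similar W v ∩ inPart u
    few-misses : ∀ x → X x ≡ true → count (deviation W v u ∩ ∁ (G x)) ≤ suc c₀
    few-misses x x∈ = begin
      count (deviation W v u ∩ ∁ (G x))
        ≤⟨ count-cover ⁅ x ⁆ (λ y → N W v y xor N W x y) (deviation-misses W v u (eqb-sound (∧-elimʳ {similar W v x} x∈))) ⟩
      count ⁅ x ⁆ + symDiffSize (N W v) (N W x)
        ≤⟨ +-mono-≤ (≤-reflexive (count-singleton x)) (similar-≤-c₀ W v x (∧-elimˡ {similar W v x} x∈)) ⟩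
      suc c₀ ∎
      where open ≤-Reasoning

  similarityDegree-if-all-far : ∀ W v → (∀ u → α < count (deviation W v u)) →
    similarityDegree W v ≤ K * (4 * d)
  similarityDegree-if-all-far W v far =
    subst (_≤ K * (4 * d)) (sym (count-by-parts part (similar W v)))
          (sum-bound (4 * d) (λ u → few-similar-in-far-part W v u (far u)))

  close-row : ∀ W v → threshold ≤ count W → Maximiser W v → ∃ λ u → count (deviation W v u) ≤ α
  close-row W v large max with find (λ u → does (count (deviation W v u) ≤? α))
  ... | inj₁ (u , close) = u , ≤?-sound close
  ... | inj₂ none = ⊥-elim (<⇒≱ threshold-beats-similarity (begin
    1100 * d * K ^ 5                      ≤⟨ large ⟩
    count W                               ≤⟨ lowDegree-majority W ⟩
    2 * count (lowDegree W)               ≤⟨ *-monoʳ-≤ 2 (lowDegree-count W v max) ⟩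
    2 * (K * (similarityDegree W v + 1))  ≤⟨ *-monoʳ-≤ 2 (*-monoʳ-≤ K (+-monoˡ-≤ 1 all-far)) ⟩
    2 * (K * (K * (4 * d) + 1))           ∎))
    where
    open ≤-Reasoning
    all-far : similarityDegree W v ≤ K * (4 * d)
    all-far = similarityDegree-if-all-far W v (λ u → ≰⇒> (≤?-refute (none u)))

  record Approximates (W recorded : VSet n) (u : Fin K) (S : VSet n) : Set where
    field
      errors          : VSet n
      errors-≤        : count errors ≤ α
      errors-recorded : errors ⊆ recorded
      agrees          : ∀ y → W y ≡ true → S y ≡ (R u (part y) xor errors y)

  approx-record : ∀ {W Z Z' u S} → Z ⊆ Z' → Approximates W Z u S → Approximates W Z' u S
  approx-record Z⊆Z' a = record
    { errors = errors ; errors-≤ = errors-≤ ; agrees = agrees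
    ; errors-recorded = λ y h → Z⊆Z' y (errors-recorded y h) }
    where open Approximates a

  approx-shrink : ∀ {W W' Z u S} → W' ⊆ W → Approximates W Z u S → Approximates W' Z u S
  approx-shrink W'⊆W a = record
    { errors = errors ; errors-≤ = errors-≤ ; errors-recorded = errors-recorded
    ; agrees = λ y h → agrees y (W'⊆W y h) }
    where open Approximates a

  subset-of-small-part : ∀ {W w} (T : VSet n) → T ⊆ partOf W w →
                         (∀ y → T y ≡ true → count (partOf W w) ≤ β) → count T ≤ β
  subset-of-small-part T T⊆ certify with find T
  ... | inj₂ none       = subst (_≤ β) (sym (count-none T none)) z≤n
  ... | inj₁ (y , y∈T)  = ≤-trans (count-mono T⊆) (certify y y∈T)

  setAside : VSet n → VSet n → (Fin K → VSet n) → VSet n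
  setAside exceptional small bad x = exceptional x ∨ (small x ∨ ⋁ (λ w → bad w x))

  -- The covered nodes are the rows of R
  -- approximated by members of 𝒮, one new row per member, so at most α·|covered|
  -- vertices are exceptional. A part is small once at most β of its vertices
  -- remain in W, and its remaining vertices are then set aside (at most β per
  -- part). A bad vertex for part w is a removed vertex adjacent in G to all but
  -- γ vertices of the part (at most μ per part). Outside the set-aside
  -- vertices, F agrees with E on every pair not inside W, and has no edge inside W.
  record Invariant (W : VSet n) (F : Adj n) (𝒮 : List (VSet n)) : Set where
    field
      covered     : VSet K
      exceptional : VSet n
      small       : VSet n
      bad         : Fin K → VSet n
      exceptional-≤        : count exceptional ≤ α * count covered
      members-approximate  : ∀ S → S ∈ 𝒮 → ∃ λ u → Approximates W exceptional u S
      covered-approximated : ∀ u → covered u ≡ true → ∃ λ S → S ∈ 𝒮 × Approximates W exceptional u S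
      small-≤              : ∀ w → count (small ∩ inPart w) ≤ β
      large-not-small      : ∀ w → β < count (partOf W w) → ∀ y → part y ≡ w → small y ≡ false
      small-complete       : ∀ w → count (partOf W w) ≤ β → ∀ y → part y ≡ w → W y ≡ true → small y ≡ true
      bad-nearly-complete  : ∀ w x → bad w x ≡ true → count (partOf W w ∩ ∁ (G x)) ≤ γ
      bad-≤                : ∀ w → count (bad w) ≤ μ
      F-agrees : ∀ x y → setAside exceptional small bad x ≡ false → setAside exceptional small bad y ≡ false →
                 F x y ≡ (not (W x ∧ W y) ∧ E x y)

  -- The new member N(v) approximates a row u that was
  -- not covered before, with the deviation set as its errors.
  module NewSet {W F 𝒮} (I : Invariant W F 𝒮) (v : Fin n) (large : threshold ≤ count W)
                (no-match : ¬ ∃ λ x → ∃ λ S → Match W 𝒮 x S) (W-v : W v ≡ true) (max : Maximiser W v) where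

    open Invariant I

    u : Fin K
    u = proj₁ (close-row W v large max)

    A : VSet n
    A = deviation W v u

    A-≤ : count A ≤ α
    A-≤ = proj₂ (close-row W v large max)

    -- Where N(v) and a member S differ, N(v) deviates from row u or S errs.
    difference-via-row : ∀ w a r z s → (w ≡ true → s ≡ (r xor z)) → (w ≡ false → a ≡ false) →
                         (a xor (s ∧ w)) ≡ true → ((a xor (w ∧ r)) ∨ z) ≡ true
    difference-via-row true  a r true  s S≈ _ _ = 𝔹.∨-zeroʳ _
    difference-via-row true  a r false s S≈ _ h rewrite S≈ refl =
      trans (𝔹.∨-identityʳ _) (trans (cong (a xor_) (trans (𝔹.∧-identityˡ r) (sym (𝔹.xor-identityʳ r))))
                                    (trans (cong (a xor_) (sym (𝔹.∧-identityʳ _))) h))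
    difference-via-row false a r z s _ a≡ h =
      ⊥-elim (true≢false (trans (sym h) (trans (cong (_xor (s ∧ false)) (a≡ refl)) (𝔹.∧-zeroʳ s))))

    -- Had u been covered, v would match the member approximating row u.
    u-uncovered : covered u ≡ false
    u-uncovered with covered u in cov
    ... | false = refl
    ... | true  = ⊥-elim (no-match (v , S , W-v , S∈ , close))
      where
      S = proj₁ (covered-approximated u cov)
      S∈ = proj₁ (proj₂ (covered-approximated u cov))
      open Approximates (proj₂ (proj₂ (covered-approximated u cov)))
      close : symDiffSize (N W v) (S ∩ W) ≤ 1140 * d * K ^ 4
      close = ≤-trans (count-cover A errors (λ y → difference-via-row (W y) (N W v y) (R u (part y)) (errors y) (S y)
                                                   (agrees y) (λ W-y → cong (_∧ H v y) W-y)))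
                      (≤-trans (+-mono-≤ A-≤ errors-≤) α+α≤c₁)

    new-member : Approximates W (exceptional ∪ A) u (N W v)
    new-member = record
      { errors = A ; errors-≤ = A-≤ ; errors-recorded = λ y → ∨-introʳ (exceptional y)
      ; agrees = λ y W-y → trans (xor-cancel (N W v y) (R u (part y)))
                                 (cong (λ b → R u (part y) xor (N W v y xor (b ∧ R u (part y)))) (sym W-y)) }
      where
      xor-cancel : ∀ a r → a ≡ (r xor (a xor r))
      xor-cancel true  true  = refl
      xor-cancel true  false = refl
      xor-cancel false true  = refl
      xor-cancel false false = refl

    exceptional-≤′ : count (exceptional ∪ A) ≤ α * count (covered ∪ ⁅ u ⁆)
    exceptional-≤′ = begin
      count (exceptional ∪ A)                ≤⟨ count-∪ exceptional A ⟩
      count exceptional + count A            ≤⟨ +-mono-≤ exceptional-≤ A-≤ ⟩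
      α * count covered + α                  ≡⟨ cong (α * count covered +_) (sym (*-identityʳ α)) ⟩
      α * count covered + α * 1              ≡⟨ sym (*-distribˡ-+ α (count covered) 1) ⟩
      α * (count covered + 1)                ≡⟨ cong (λ k → α * (count covered + k)) (sym (count-singleton u)) ⟩
      α * (count covered + count ⁅ u ⁆)      ≡⟨ cong (α *_) (sym (count-disjoint-∪ covered ⁅ u ⁆ u-elsewhere)) ⟩
      α * count (covered ∪ ⁅ u ⁆)            ∎
      where
      open ≤-Reasoning
      u-elsewhere : ∀ w → covered w ≡ true → eqb w u ≡ false
      u-elsewhere w cov-w = eqb-≢ {x = w} {u} λ { refl → true≢false (trans (sym cov-w) u-uncovered) }

    grown : exceptional ⊆ (exceptional ∪ A)
    grown y = ∨-introˡ (A y)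

    invariant : Invariant W F (𝒮 ++ N W v ∷ [])
    invariant = record
      { covered = covered ∪ ⁅ u ⁆
      ; exceptional = exceptional ∪ A
      ; small = small
      ; bad = bad
      ; exceptional-≤ = exceptional-≤′
      ; members-approximate = members
      ; covered-approximated = covered′
      ; small-≤ = small-≤
      ; large-not-small = large-not-small
      ; small-complete = small-complete
      ; bad-nearly-complete = bad-nearly-complete
      ; bad-≤ = bad-≤
      ; F-agrees = λ x y x∉ y∉ → F-agrees x y (still-outside x x∉) (still-outside y y∉)
      }
      where
      members : ∀ S → S ∈ 𝒮 ++ N W v ∷ [] → ∃ λ w → Approximates W (exceptional ∪ A) w S
      members S S∈ with ∈-++⁻ 𝒮 S∈
      ... | inj₁ S∈𝒮 = proj₁ (members-approximate S S∈𝒮) , approx-record grown (proj₂ (members-approximate S S∈𝒮))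
      ... | inj₂ (here refl) = u , new-member
      covered′ : ∀ w → (covered ∪ ⁅ u ⁆) w ≡ true → ∃ λ S → S ∈ 𝒮 ++ N W v ∷ [] × Approximates W (exceptional ∪ A) w S
      covered′ w h with ∨-elim {covered w} h
      ... | inj₁ cov-w = let (S , S∈ , a) = covered-approximated w cov-w in S , ∈-++⁺ˡ S∈ , approx-record grown a
      ... | inj₂ w≡u rewrite eqb-sound {x = w} w≡u = N W v , ∈-++⁺ʳ 𝒮 (here refl) , new-member
      still-outside : ∀ x → setAside (exceptional ∪ A) small bad x ≡ false → setAside exceptional small bad x ≡ false
      still-outside x h with exceptional x
      ... | true  = h
      ... | false = proj₂ (∨-false {A x} h)

  -- A removal step: v ∈ W matches the member S, which approximates row u.
  -- v is removed and joined to S ∩ W′; v may become "bad" for some large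
  -- parts, and the part of v may become small.
  module Removal {W F 𝒮} (I : Invariant W F 𝒮) (v : Fin n) (S : VSet n) (match : Match W 𝒮 v S) where

    open Invariant I

    W′ : VSet n
    W′ = remove W v

    W-v : W v ≡ true
    W-v = proj₁ match

    S-approximates : ∃ λ u → Approximates W exceptional u S
    S-approximates = members-approximate S (proj₁ (proj₂ match))

    u : Fin K
    u = proj₁ S-approximates

    open Approximates (proj₂ S-approximates)

    partOf-shrinks : ∀ w → partOf W′ w ⊆ partOf W w
    partOf-shrinks w y h = ∧-intro (remove-⊆ W v y (∧-elimˡ h)) (∧-elimʳ {W′ y} h)

    partOf-unchanged : ∀ w → part v ≢ w → count (partOf W′ w) ≡ count (partOf W w)
    partOf-unchanged w pv≢w = count-cong pointwise
      where
      pointwise : ∀ y → partOf W′ w y ≡ partOf W w y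
      pointwise y with y ≟ v
      ... | yes refl rewrite eqb-≢ pv≢w = trans (𝔹.∧-zeroʳ _) (sym (𝔹.∧-zeroʳ _))
      ... | no _ = cong (_∧ inPart w y) (𝔹.∧-identityʳ (W y))

    newlySmall : VSet n
    newlySmall y = inPart (part v) y ∧ (W′ y ∧ does (count (partOf W′ (part v)) ≤? β))

    small′ : VSet n
    small′ = small ∪ newlySmall

    newlySmall-≤ : count newlySmall ≤ β
    newlySmall-≤ = subset-of-small-part newlySmall newly⊆
                     (λ y new → ≤?-sound (∧-elimʳ {W′ y} (∧-elimʳ {inPart (part v) y} new)))
      where
      newly⊆ : newlySmall ⊆ partOf W′ (part v)
      newly⊆ z h = ∧-intro (∧-elimˡ {W′ z} (∧-elimʳ {inPart (part v) z} h)) (∧-elimˡ h)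

    small-≤′ : ∀ w → count (small′ ∩ inPart w) ≤ β
    small-≤′ w with part v ≟ w
    ... | no pv≢w = ≤-trans (count-mono only-old) (small-≤ w)
      where
      only-old : (small′ ∩ inPart w) ⊆ (small ∩ inPart w)
      only-old y h with ∨-elim {small y} (∧-elimˡ h)
      ... | inj₁ s = ∧-intro s (∧-elimʳ {small′ y} h)
      ... | inj₂ new = ⊥-elim (pv≢w (trans (sym (eqb-sound {x = part y} {part v} (∧-elimˡ {inPart (part v) y} new)))
                                          (eqb-sound {x = part y} {w} (∧-elimʳ {small′ y} h))))
    ... | yes refl with count (partOf W (part v)) ≤? β
    ...   | yes was-small = ≤-trans (count-mono already) (small-≤ (part v))
      where
      already : (small′ ∩ inPart (part v)) ⊆ (small ∩ inPart (part v))
      already y h with ∨-elim {small y} (∧-elimˡ h)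
      ... | inj₁ s = ∧-intro s (∧-elimʳ {small′ y} h)
      ... | inj₂ new = ∧-intro (small-complete (part v) was-small y
                                  (eqb-sound {x = part y} {part v} (∧-elimˡ {inPart (part v) y} new))
                                  (remove-⊆ W v y (∧-elimˡ {W′ y} (∧-elimʳ {inPart (part v) y} new))))
                               (∧-elimʳ {small′ y} h)
    ...   | no was-large = ≤-trans (count-mono only-new) newlySmall-≤
      where
      only-new : (small′ ∩ inPart (part v)) ⊆ newlySmall
      only-new y h with ∨-elim {small y} (∧-elimˡ h)
      ... | inj₁ s = ⊥-elim (true≢false (trans (sym s)
                       (large-not-small (part v) (≰⇒> was-large) y (eqb-sound {x = part y} {part v} (∧-elimʳ {small′ y} h)))))
      ... | inj₂ new = new

    large-not-small′ : ∀ w → β < count (partOf W′ w) → ∀ y → part y ≡ w → small′ y ≡ false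
    large-not-small′ w big y py =
      trans (cong (_∨ newlySmall y) (large-not-small w (<-≤-trans big (count-mono (partOf-shrinks w))) y py)) not-new
      where
      not-new : (inPart (part v) y ∧ (W′ y ∧ does (count (partOf W′ (part v)) ≤? β))) ≡ false
      not-new with inPart (part v) y in same
      ... | false = refl
      ... | true  = trans (cong (W′ y ∧_) (≤?-false λ le → <⇒≱ big
                      (subst (λ p → count (partOf W′ p) ≤ β) (trans (sym (eqb-sound {x = part y} {part v} same)) py) le)))
                      (𝔹.∧-zeroʳ (W′ y))

    small-complete′ : ∀ w → count (partOf W′ w) ≤ β → ∀ y → part y ≡ w → W′ y ≡ true → small′ y ≡ true
    small-complete′ w ≤β y py W′-y with count (partOf W w) ≤? β
    ... | yes was-small = ∨-introˡ (newlySmall y) (small-complete w was-small y py (remove-⊆ W v y W′-y))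
    ... | no was-large with part v ≟ w
    ...   | no pv≢w  = ⊥-elim (was-large (subst (_≤ β) (partOf-unchanged w pv≢w) ≤β))
    ...   | yes refl = ∨-introʳ (small y) (∧-intro (eqb-complete py) (∧-intro W′-y (≤?-true ≤β)))

    becomesBad : Fin K → Bool
    becomesBad w = not (does (count (partOf W w) ≤? β)) ∧ does (count (partOf W w ∩ ∁ (G v)) ≤? γ)

    bad′ : Fin K → VSet n
    bad′ w x = bad w x ∨ (eqb x v ∧ becomesBad w)

    bad′-nearly-complete-in-W : ∀ w x → bad′ w x ≡ true → count (partOf W w ∩ ∁ (G x)) ≤ γ
    bad′-nearly-complete-in-W w x h with ∨-elim {bad w x} h
    ... | inj₁ old = bad-nearly-complete w x old
    ... | inj₂ new with eqb-sound {x = x} {v} (∧-elimˡ {eqb x v} new)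
    ...   | refl = ≤?-sound (∧-elimʳ {not (does (count (partOf W w) ≤? β))} (∧-elimʳ {eqb x v} new))

    bad-nearly-complete′ : ∀ w x → bad′ w x ≡ true → count (partOf W′ w ∩ ∁ (G x)) ≤ γ
    bad-nearly-complete′ w x h = ≤-trans (count-mono shrink) (bad′-nearly-complete-in-W w x h)
      where
      shrink : (partOf W′ w ∩ ∁ (G x)) ⊆ (partOf W w ∩ ∁ (G x))
      shrink y h = ∧-intro (partOf-shrinks w y (∧-elimˡ h)) (∧-elimʳ {partOf W′ w y} h)

    -- A small part gains no bad vertex; a large part has at most μ of them,
    -- since they are all nearly complete to it.
    bad-≤′ : ∀ w → count (bad′ w) ≤ μ
    bad-≤′ w with count (partOf W w) ≤? β
    ... | yes was-small = subst (_≤ μ) (sym (count-cong no-new)) (bad-≤ w)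
      where
      no-new : ∀ x → bad′ w x ≡ bad w x
      no-new x = trans (cong (λ b → bad w x ∨ (eqb x v ∧ (not b ∧ does (count (partOf W w ∩ ∁ (G v)) ≤? γ))))
                              (≤?-true was-small))
                       (trans (cong (bad w x ∨_) (𝔹.∧-zeroʳ (eqb x v))) (𝔹.∨-identityʳ (bad w x)))
    ... | no was-large = *-cancelʳ-≤ (count (bad′ w)) μ τ
        (≤-trans (almost-complete-bound γ τ (bad′ w) (partOf W w) (bad′-nearly-complete-in-W w) (<⇒≤ (≰⇒> was-large)))
                 2dβ≤μτ)

    set-aside′ : VSet n
    set-aside′ = setAside exceptional small′ bad′

    outside-parts : ∀ x → set-aside′ x ≡ false →
                    exceptional x ≡ false × small′ x ≡ false × (∀ w → bad′ w x ≡ false)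
    outside-parts x h = let (e , rest) = ∨-false {exceptional x} h
                            (s , b) = ∨-false {small′ x} rest
                        in e , s , ⋁-false (λ w → bad′ w x) b

    still-outside : ∀ x → set-aside′ x ≡ false → setAside exceptional small bad x ≡ false
    still-outside x h = let (e , s , b) = outside-parts x h in
      trans (cong₂ (λ p q → p ∨ (q ∨ ⋁ (λ w → bad w x))) e (proj₁ (∨-false {small x} s)))
            (⋁-none (λ w → bad w x) (λ w → proj₁ (∨-false {bad w x} (b w))))

    -- Where rows u and (part v) of R differ on part w, every non-neighbour of v
    -- in that part is v itself, an error of S, or a vertex where N(v) and S differ.
    misses-where-rows-differ : ∀ w → R u w ≢ R (part v) w → count (partOf W w ∩ ∁ (G v)) ≤ γ
    misses-where-rows-differ w rows-differ = begin
      count (partOf W w ∩ ∁ (G v))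
        ≤⟨ count-cover ⁅ v ⁆ (errors ∪ (λ y → N W v y xor (S ∩ W) y)) cover ⟩
      count ⁅ v ⁆ + count (errors ∪ (λ y → N W v y xor (S ∩ W) y))
        ≤⟨ +-mono-≤ (≤-reflexive (count-singleton v))
                    (≤-trans (count-∪ errors _) (+-mono-≤ errors-≤ (proj₂ (proj₂ match)))) ⟩
      γ ∎
      where
      open ≤-Reasoning
      cover : (partOf W w ∩ ∁ (G v)) ⊆ (⁅ v ⁆ ∪ (errors ∪ (λ y → N W v y xor (S ∩ W) y)))
      cover y h with y ≟ v
      ... | yes _  = refl
      ... | no y≢v with errors y in err
      ...   | true  = refl
      ...   | false = subst₂ (λ a b → (a xor b) ≡ true) (sym N-v-y) (sym S-y) (xor-differ (rows-differ ∘ sym))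
        where
        W-y = ∧-elimˡ {W y} (∧-elimˡ {partOf W w y} h)
        part-y = eqb-sound {x = part y} {w} (∧-elimʳ {W y} (∧-elimˡ {partOf W w y} h))
        G-v-y = not-true (∧-elimʳ {partOf W w y} h)
        N-v-y : N W v y ≡ R (part v) w
        N-v-y = trans (N-off-diagonal W (λ e → y≢v (sym e)))
                      (trans (cong₂ (λ a b → a ∧ (b xor R (part v) (part y))) W-y G-v-y) (cong (R (part v)) part-y))
        S-y : (S y ∧ W y) ≡ R u w
        S-y = trans (cong (S y ∧_) W-y) (trans (𝔹.∧-identityʳ (S y)) (trans (agrees y W-y)
                (trans (cong (R u (part y) xor_) err) (trans (𝔹.xor-identityʳ _) (cong (R u) part-y)))))

    -- The key claim: for outside vertices b ∈ W, S b is the E-adjacency of v and b.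
    -- Otherwise rows u and (part v) differ on the part of b, which is then either
    -- small (so b is set aside) or large (so v is bad for it and set aside).
    joined-correctly : ∀ b → b ≢ v → W b ≡ true → set-aside′ b ≡ false → set-aside′ v ≡ false →
                       S b ≡ R (part v) (part b)
    joined-correctly b b≢v W-b b-out v-out with R u (part b) 𝔹.≟ R (part v) (part b)
    ... | yes same-row = trans (agrees b W-b) (trans (cong (R u (part b) xor_) no-error) (trans (𝔹.xor-identityʳ _) same-row))
      where
      no-error : errors b ≡ false
      no-error with errors b in err
      ... | false = refl
      ... | true  = ⊥-elim (true≢false (trans (sym (errors-recorded b err)) (proj₁ (outside-parts b b-out))))
    ... | no rows-differ with count (partOf W (part b)) ≤? β
    ...   | yes was-small = ⊥-elim (true≢false (trans (sym (∨-introˡ (newlySmall b)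
                              (small-complete (part b) was-small b refl W-b))) (proj₁ (proj₂ (outside-parts b b-out)))))
    ...   | no was-large = ⊥-elim (true≢false (trans (sym v-bad) (proj₂ (proj₂ (outside-parts v v-out)) (part b))))
      where
      v-bad : bad′ (part b) v ≡ true
      v-bad = ∨-introʳ (bad (part b) v) (∧-intro (eqb-refl v)
                (∧-intro (cong not (≤?-false was-large)) (≤?-true (misses-where-rows-differ (part b) rows-differ))))

    join-at-v : ∀ {f e} y → y ≢ v → set-aside′ y ≡ false → set-aside′ v ≡ false →
                e ≡ R (part v) (part y) → f ≡ (not (W y) ∧ e) → (f ∨ (S y ∧ W′ y)) ≡ e
    join-at-v {f} y y≢v y-out v-out e≡ f≡ =
      trans (cong (λ b → f ∨ (S y ∧ b)) (remove-other W y≢v))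
            (join-value f≡ (λ W-y → trans (joined-correctly y y≢v W-y y-out v-out) (sym e≡)))

    F-agrees-by-cases : ∀ {x y} → Dec (x ≡ v) → Dec (y ≡ v) → set-aside′ x ≡ false → set-aside′ y ≡ false →
                        joinTo F v (S ∩ W′) x y ≡ (not (W′ x ∧ W′ y) ∧ E x y)
    F-agrees-by-cases (yes refl) (yes refl) x-out _ = begin
      joinTo F v (S ∩ W′) v v        ≡⟨ join-loop F (S ∩ W′) (trans (cong (S v ∧_) (remove-self W v)) (𝔹.∧-zeroʳ (S v))) ⟩
      F v v                          ≡⟨ F-agrees v v (still-outside v x-out) (still-outside v x-out) ⟩
      not (W v ∧ W v) ∧ E v v        ≡⟨ cong (not (W v ∧ W v) ∧_) (E-diagonal v) ⟩
      not (W v ∧ W v) ∧ false        ≡⟨ trans (𝔹.∧-zeroʳ _) (sym (𝔹.∧-zeroʳ _)) ⟩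
      not (W′ v ∧ W′ v) ∧ false      ≡⟨ cong (not (W′ v ∧ W′ v) ∧_) (sym (E-diagonal v)) ⟩
      not (W′ v ∧ W′ v) ∧ E v v      ∎
      where open ≡-Reasoning
    F-agrees-by-cases {y = y} (yes refl) (no y≢v) x-out y-out = begin
      joinTo F v (S ∩ W′) v y        ≡⟨ join-from F (S ∩ W′) y≢v ⟩
      F v y ∨ (S y ∧ W′ y)           ≡⟨ join-at-v y y≢v y-out x-out (E-off-diagonal (λ e → y≢v (sym e)))
                                          (trans (F-agrees v y (still-outside v x-out) (still-outside y y-out))
                                                 (cong (λ b → not (b ∧ W y) ∧ E v y) W-v)) ⟩
      E v y                          ≡⟨ cong (λ b → not (b ∧ W′ y) ∧ E v y) (sym (remove-self W v)) ⟩
      not (W′ v ∧ W′ y) ∧ E v y      ∎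
      where open ≡-Reasoning
    F-agrees-by-cases {x = x} (no x≢v) (yes refl) x-out y-out = begin
      joinTo F v (S ∩ W′) x v        ≡⟨ join-to F (S ∩ W′) x≢v ⟩
      F x v ∨ (S x ∧ W′ x)           ≡⟨ join-at-v x x≢v x-out y-out
                                          (trans (E-off-diagonal x≢v) (R-symmetric (part x) (part v)))
                                          (trans (F-agrees x v (still-outside x x-out) (still-outside v y-out))
                                                 (cong (λ b → not b ∧ E x v) (trans (cong (W x ∧_) W-v) (𝔹.∧-identityʳ (W x))))) ⟩
      E x v                          ≡⟨ cong (λ b → not b ∧ E x v) (sym (trans (cong (W′ x ∧_) (remove-self W v)) (𝔹.∧-zeroʳ (W′ x)))) ⟩
      not (W′ x ∧ W′ v) ∧ E x v      ∎
      where open ≡-Reasoning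
    F-agrees-by-cases {x} {y} (no x≢v) (no y≢v) x-out y-out = begin
      joinTo F v (S ∩ W′) x y        ≡⟨ join-away F (S ∩ W′) x≢v y≢v ⟩
      F x y                          ≡⟨ F-agrees x y (still-outside x x-out) (still-outside y y-out) ⟩
      not (W x ∧ W y) ∧ E x y        ≡⟨ cong₂ (λ a b → not (a ∧ b) ∧ E x y) (sym (remove-other W x≢v)) (sym (remove-other W y≢v)) ⟩
      not (W′ x ∧ W′ y) ∧ E x y      ∎
      where open ≡-Reasoning

    F-agrees′ : ∀ x y → set-aside′ x ≡ false → set-aside′ y ≡ false →
                joinTo F v (S ∩ W′) x y ≡ (not (W′ x ∧ W′ y) ∧ E x y)
    F-agrees′ x y = F-agrees-by-cases (x ≟ v) (y ≟ v)

    invariant : Invariant W′ (joinTo F v (S ∩ W′)) 𝒮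
    invariant = record
      { covered = covered
      ; exceptional = exceptional
      ; small = small′
      ; bad = bad′
      ; exceptional-≤ = exceptional-≤
      ; members-approximate = λ T T∈ → let (w , a) = members-approximate T T∈ in w , approx-shrink (remove-⊆ W v) a
      ; covered-approximated = λ w cov → let (T , T∈ , a) = covered-approximated w cov in T , T∈ , approx-shrink (remove-⊆ W v) a
      ; small-≤ = small-≤′
      ; large-not-small = large-not-small′
      ; small-complete = small-complete′
      ; bad-nearly-complete = bad-nearly-complete′
      ; bad-≤ = bad-≤′
      ; F-agrees = F-agrees′
      }

  everything : VSet n
  everything _ = true

  initial-invariant : Invariant everything edgeless []
  initial-invariant = record
    { covered = λ _ → false
    ; exceptional = λ _ → false
    ; small = small₀
    ; bad = λ _ _ → false
    ; exceptional-≤ = subst (_≤ α * count {K} (λ _ → false)) (sym (count-none {n} (λ _ → false) (λ _ → refl))) z≤n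
    ; members-approximate = λ _ ()
    ; covered-approximated = λ _ ()
    ; small-≤ = λ w → subset-of-small-part (small₀ ∩ inPart w) (λ y → ∧-elimʳ {small₀ y})
                        (λ y h → subst (λ p → count (partOf everything p) ≤ β)
                                       (eqb-sound {x = part y} {w} (∧-elimʳ {small₀ y} h)) (≤?-sound (∧-elimˡ h)))
    ; large-not-small = λ w big y py →
        ≤?-false (λ le → <⇒≱ big (subst (λ p → count (partOf everything p) ≤ β) py le))
    ; small-complete = λ w ≤β y py _ → ≤?-true (subst (λ p → count (partOf everything p) ≤ β) (sym py) ≤β)
    ; bad-nearly-complete = λ _ _ ()
    ; bad-≤ = λ w → subst (_≤ μ) (sym (count-none {n} (λ _ → false) (λ _ → refl))) z≤n
    ; F-agrees = λ _ _ _ _ → refl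
    }
    where
    small₀ : VSet n
    small₀ y = does (count (partOf everything (part y)) ≤? β)

  Result : Adj n → Set
  Result F = Σ (VSet n) λ U → count U ≤ 4000 * d * K ^ 6 ×
               (∀ x y → U x ≡ false → U y ≡ false → F x y ≡ E x y)

  -- When the procedure stops, W is small; setting W aside as well leaves F = E.
  conclusion : ∀ {W F 𝒮} → count W < threshold → Invariant W F 𝒮 → Result F
  conclusion {W} {F} W-small I = U , U-≤ , F≡E
    where
    open Invariant I
    anyBad : VSet n
    anyBad x = ⋁ (λ w → bad w x)
    U : VSet n
    U = setAside exceptional small bad ∪ W
    aside-≤ : count (setAside exceptional small bad) ≤ α * K + (K * β + K * μ)
    aside-≤ = begin
      count (exceptional ∪ (small ∪ anyBad))          ≤⟨ count-∪ exceptional (small ∪ anyBad) ⟩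
      count exceptional + count (small ∪ anyBad)      ≤⟨ +-mono-≤ ≤-refl (count-∪ small anyBad) ⟩
      count exceptional + (count small + count anyBad)
        ≤⟨ +-mono-≤ (≤-trans exceptional-≤ (*-monoʳ-≤ α (count-≤-size covered)))
                    (+-mono-≤ (≤-trans (≤-reflexive (count-by-parts part small)) (sum-bound β small-≤))
                              (≤-trans (count-⋁ bad) (sum-bound μ bad-≤))) ⟩
      α * K + (K * β + K * μ)                         ∎
      where open ≤-Reasoning
    U-≤ : count U ≤ 4000 * d * K ^ 6
    U-≤ = ≤-trans (count-∪ (setAside exceptional small bad) W)
                  (≤-trans (+-mono-≤ aside-≤ (<⇒≤ W-small)) final-budget)
    F≡E : ∀ x y → U x ≡ false → U y ≡ false → F x y ≡ E x y
    F≡E x y x∉U y∉U =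
      let (x-out , W-x) = ∨-false {setAside exceptional small bad x} x∉U
          (y-out , _)   = ∨-false {setAside exceptional small bad y} y∉U
      in trans (F-agrees x y x-out y-out) (cong (λ b → not (b ∧ W y) ∧ E x y) W-x)

  step-preserves : ∀ {s s′} → Step s s′ →
    Invariant (State.W s) (State.F s) (State.𝒮 s) → Invariant (State.W s′) (State.F s′) (State.𝒮 s′)
  step-preserves (remove-step v S _ match) I = Removal.invariant I v S match
  step-preserves (new-step v large no-match W-v max) I = NewSet.invariant I v large no-match W-v max

  outputs-satisfy : ∀ {s F} → Outputs s F → Invariant (State.W s) (State.F s) (State.𝒮 s) → Result F
  outputs-satisfy (halt W-small) I = conclusion W-small I
  outputs-satisfy (next step out) I = outputs-satisfy out (step-preserves step I)

-- With no nodes, or with d = 0, the threshold is 0 and the procedure never stops.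
no-output : ∀ {n} (H : Adj n) (d K : ℕ) → Procedure.threshold H d K ≡ 0 →
            ∀ {s F} → ¬ Procedure.Outputs H d K s F
no-output H d K zero-threshold (Procedure.halt {W} W-small) = n≮0 (subst (count W <_) zero-threshold W-small)
no-output H d K zero-threshold (Procedure.next _ out) = no-output H d K zero-threshold out

lemma12 : (n K d : ℕ) (R : Adj K) → IsPattern R →
          (G : Adj n) → IsSimpleGraph G → Degenerate d G →
          (part : Fin n → Fin K) (F : Adj n) →
          Procedure.Outputs (flipR R part G) d K (Procedure.initial (flipR R part G) d K) F →
          Σ (VSet n) λ U → count U ≤ 4000 * d * K ^ 6 ×
            (∀ x y → U x ≡ false → U y ≡ false → F x y ≡ flipR R part edgeless x y)
lemma12 n zero d R _ G _ _ part F out = ⊥-elim (no-output (flipR R part G) d zero (*-zeroʳ (1100 * d)) out)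
lemma12 n (suc k) zero R _ G _ _ part F out = ⊥-elim (no-output (flipR R part G) zero (suc k) refl out)
lemma12 n (suc k) (suc e) R R-pattern G simple degenerate part F out =
  outputs-satisfy out initial-invariant
  where open Analysis R (IsPattern.symmetric R-pattern) simple degenerate part
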